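{- Let $G=U\times V$ be a finite CI-group with $\gcd(|U|,|V|)=1$, where $U$ is abelian and $V$ is one of: (1) $H_e(M,2^r3^s,l)$ for some type $e$, where $M$ is abelian, $r,s\geq0$ and $r+s\geq1$; (2) $H_2(M,2^r,l)\times H_3(M',3^s,l')$, where $|M|$, $2$, $|M'|$, $3$ are pairwise coprime, $M,M'$ are abelian, $1\leq r\leq3$, $1\leq s\leq2$ and $l,l'>1$. Then $G$ does not have the $k$-if property for any integer $k\geq2$.
   Context: Definition of $H_e(M,2^r3^s,l)$: let $M$ be a finite abelian group all of whose Sylow subgroups are homocyclic (direct products of cyclic groups of equal order), $m$ the exponent of $M$, $l$ an integer with $1\leq l\leq m$ and $\gcd(l(l-1),m)=1$, and $e$ the least positive integer with $l^e\equiv1\pmod m$. Let $r,s\geq0$ be integers such that one of the following holds: $e=2$, $r\geq1$, $s=0$, $m$ odd; $e=3$, $r=0$, $s\geq1$, $3\nmid m$; $e=4$, $r\geq2$, $s=0$, $m$ odd; $e=6$, $r\geq1$, $s\geq1$, $\gcd(m,6)=1$. Then $H_e(M,2^r3^s,l)=\langle M,z\mid z^{2^r3^s}=1,\ x^z=x^l\ \forall x\in M\rangle$ (the semidirect product $M\rtimes\langle z\rangle$), said to be of type $e$. For a finite group $G$ let $G^*=G\setminus\{1\}$. For an inverse-closed $S\subseteq G^*$, $\mathrm{Cay}(G,S)$ has vertex set $G$ and edges $\{h,g\}$ with $gh^{ -1}\in S$. $G$ is a CI-group if for all inverse-closed $S,T\subseteq G^*$, $\mathrm{Cay}(G,S)\cong\mathrm{Cay}(G,T)$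 implies $T=S^{\alpha}$ for some $\alpha\in\mathrm{Aut}(G)$. A partition of a set is a collection of non-empty pairwise disjoint subsets whose union is the set. $\mathrm{Cay}(G,S)$ is a $k$-if Cayley graph if there is a partition $\{S_0=S,\dots,S_{k-1}\}$ of $G^*$ into inverse-closed subsets with $\mathrm{Cay}(G,S_i)\cong\mathrm{Cay}(G,S)$ for all $i$; $G$ has the $k$-if property if some $\mathrm{Cay}(G,S)$ is a $k$-if Cayley graph. -}

module Defs where

open import Data.Nat using (ℕ; zero; suc; _+_; _*_; _∸_; _^_; _≤_; _<_)
open import Data.Nat.DivMod using (_mod_)
open import Data.Nat.Divisibility using (_∣_)
open import Data.Nat.GCD using (gcd)
open import Data.Nat.Primality using (Prime)
open import Data.Fin using (Fin; toℕ)
open import Data.Fin.Subset using (Subset; _∈_; _∉_)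
open import Data.Vec using (Vec; zipWith)
open import Data.Product using (Σ; ∃; ∃-syntax; _×_; _,_)
open import Data.Sum using (_⊎_)
open import Data.Empty using (⊥)
open import Relation.Nullary using (¬_)
open import Relation.Binary.PropositionalEquality using (_≡_; _≢_)
open import Function.Bundles using (_⇔_)
open import Function.Definitions using (Bijective; Injective)
open import Algebra.Structures using (IsGroup)

-- Finite groups.  Every finite group of order n is (isomorphic to) a
-- group structure on Fin n; we use this concrete representation with
-- propositional equality.

record FinGroup : Set where
  field
    order   : ℕ
    _∙_     : Fin order → Fin order → Fin order
    ε       : Fin order
    _⁻¹     : Fin order → Fin order
    isGroup : IsGroup _≡_ _∙_ ε _⁻¹

module _ (G : FinGroup) where
  open FinGroup G

  pow : Fin order → ℕ → Fin order
  pow x zero    = ε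
  pow x (suc k) = x ∙ pow x k

  IsAbelian : Set
  IsAbelian = ∀ x y → x ∙ y ≡ y ∙ x

  IsExponent : ℕ → Set
  IsExponent m = 1 ≤ m × (∀ x → pow x m ≡ ε)
               × (∀ k → 1 ≤ k → (∀ x → pow x k ≡ ε) → m ≤ k)

  IsAut : (Fin order → Fin order) → Set
  IsAut α = Bijective _≡_ _≡_ α × (∀ x y → α (x ∙ y) ≡ α x ∙ α y)

  InvClosed : Subset order → Set
  InvClosed S = ε ∉ S × (∀ x → x ∈ S → (x ⁻¹) ∈ S)

  -- Cay(G,S): {h,g} is an edge iff g h⁻¹ ∈ S.
  -- Cay(G,S) ≅ Cay(G,T): a bijection of vertex sets preserving adjacency.
  CayIso : Subset order → Subset order → Set
  CayIso S T = Σ (Fin order → Fin order) λ f → Bijective _≡_ _≡_ f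
             × (∀ g h → ((g ∙ (h ⁻¹)) ∈ S) ⇔ ((f g ∙ (f h ⁻¹)) ∈ T))

  IsImage : (Fin order → Fin order) → Subset order → Subset order → Set
  IsImage α S T = ∀ y → (y ∈ T) ⇔ (∃[ s ] (s ∈ S × α s ≡ y))

  IsCIGroup : Set
  IsCIGroup = ∀ (S T : Subset order) → InvClosed S → InvClosed T →
              CayIso S T → ∃[ α ] (IsAut α × IsImage α S T)

  -- Cay(G,S) is a k-if Cayley graph: a partition {S₀ = S, …, S_{k-1}}
  -- of G* into (non-empty, pairwise disjoint) inverse-closed subsets
  -- with Cay(G,Sᵢ) ≅ Cay(G,S) for all i.  (For k = 0 there is no S₀.)
  IsKIfCayley : ℕ → Subset order → Set
  IsKIfCayley zero    S = ⊥
  IsKIfCayley (suc k) S =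
    Σ (Fin (suc k) → Subset order) λ P →
        P Fin.zero ≡ S
      × (∀ i → ∃[ x ] (x ∈ P i))
      × (∀ i j → i ≢ j → ∀ x → x ∈ P i → x ∈ P j → ⊥)
      × (∀ x → x ≢ ε → ∃[ i ] (x ∈ P i))
      × (∀ i → InvClosed (P i))
      × (∀ i → CayIso (P i) S)
    where import Data.Fin as Fin

  HasKIfProperty : ℕ → Set
  HasKIfProperty k = ∃[ S ] IsKIfCayley k S

IsoTo : (A : Set) → (A → A → A) → FinGroup → Set
IsoTo A μ G = Σ (A → Fin (FinGroup.order G)) λ φ →
  Bijective _≡_ _≡_ φ × (∀ a b → φ (μ a b) ≡ FinGroup._∙_ G (φ a) (φ b))

prodMul : {A B : Set} → (A → A → A) → (B → B → B) → A × B → A × B → A × B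
prodMul μ ν (a , b) (a' , b') = (μ a a' , ν b b')

IsDirectProductOf : FinGroup → FinGroup → FinGroup → Set
IsDirectProductOf G U V =
  IsoTo (Fin (FinGroup.order U) × Fin (FinGroup.order V))
        (prodMul (FinGroup._∙_ U) (FinGroup._∙_ V)) G

addMod : {N : ℕ} → Fin N → Fin N → Fin N
addMod {suc N} i j = (toℕ i + toℕ j) mod (suc N)

SylowHomocyclic : FinGroup → ℕ → Set
SylowHomocyclic M p = ∃[ a ] ∃[ b ]
  Σ (Vec (Fin (p ^ a)) b → Fin (FinGroup.order M)) λ φ →
      Injective _≡_ _≡_ φ
    × (∀ u v → φ (zipWith addMod u v) ≡ FinGroup._∙_ M (φ u) (φ v))
    × (∀ x → (∃[ k ] (pow M x (p ^ k) ≡ FinGroup.ε M)) ⇔ (∃[ u ] (φ u ≡ x)))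

AllSylowHomocyclic : FinGroup → Set
AllSylowHomocyclic M = ∀ p → Prime p → SylowHomocyclic M p

IsMultOrder : ℕ → ℕ → ℕ → Set
IsMultOrder l m e = 1 ≤ e × m ∣ (l ^ e ∸ 1)
                  × (∀ f → 1 ≤ f → m ∣ (l ^ f ∸ 1) → e ≤ f)

TypeCondition : ℕ → ℕ → ℕ → ℕ → Set
TypeCondition e r s m =
    (e ≡ 2 × 1 ≤ r × s ≡ 0 × ¬ (2 ∣ m))
  ⊎ (e ≡ 3 × r ≡ 0 × 1 ≤ s × ¬ (3 ∣ m))
  ⊎ (e ≡ 4 × 2 ≤ r × s ≡ 0 × ¬ (2 ∣ m))
  ⊎ (e ≡ 6 × 1 ≤ r × 1 ≤ s × gcd m 6 ≡ 1)

HParams : ℕ → FinGroup → ℕ → ℕ → ℕ → Set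
HParams e M r s l =
    IsAbelian M × AllSylowHomocyclic M
  × ∃[ m ] (IsExponent M m × 1 ≤ l × l ≤ m × gcd (l * (l ∸ 1)) m ≡ 1
            × IsMultOrder l m e × TypeCondition e r s m)

-- Multiplication of M ⋊ ⟨z⟩, |z| = N, x^z = x^l.  The pair (i , x)
-- stands for z^i x; then (z^i x)(z^j y) = z^(i+j) x^(l^j) y.
semiMul : (M : FinGroup) (N l : ℕ) →
          Fin N × Fin (FinGroup.order M) → Fin N × Fin (FinGroup.order M) →
          Fin N × Fin (FinGroup.order M)
semiMul M N l (i , x) (j , y) =
  (addMod i j , FinGroup._∙_ M (pow M x (l ^ toℕ j)) y)

HCarrier : FinGroup → ℕ → ℕ → Set
HCarrier M r s = Fin (2 ^ r * 3 ^ s) × Fin (FinGroup.order M)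

HMul : (M : FinGroup) (r s l : ℕ) → HCarrier M r s → HCarrier M r s → HCarrier M r s
HMul M r s l = semiMul M (2 ^ r * 3 ^ s) l

IsH : ℕ → FinGroup → ℕ → ℕ → ℕ → FinGroup → Set
IsH e M r s l V = HParams e M r s l × IsoTo (HCarrier M r s) (HMul M r s l) V

VCase1 : FinGroup → Set
VCase1 V = ∃[ e ] Σ FinGroup λ M → ∃[ r ] ∃[ s ] ∃[ l ]
  (1 ≤ r + s × IsH e M r s l V)

VCase2 : FinGroup → Set
VCase2 V = Σ FinGroup λ M → Σ FinGroup λ M' → ∃[ r ] ∃[ s ] ∃[ l ] ∃[ l' ]
  ( gcd (FinGroup.order M) 2 ≡ 1
  × gcd (FinGroup.order M) (FinGroup.order M') ≡ 1
  × gcd (FinGroup.order M) 3 ≡ 1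
  × gcd 2 (FinGroup.order M') ≡ 1
  × gcd 2 3 ≡ 1
  × gcd (FinGroup.order M') 3 ≡ 1
  × 1 ≤ r × r ≤ 3 × 1 ≤ s × s ≤ 2 × 1 < l × 1 < l'
  × HParams 2 M r 0 l × HParams 3 M' 0 s l'
  × IsoTo (HCarrier M r 0 × HCarrier M' 0 s)
          (prodMul (HMul M r 0 l) (HMul M' 0 s l')) V )

{-# OPTIONS --safe #-}

-- Let {S₀, …, S_{k-1}} be a k-if partition of G*.  As G is a CI-group, every part is the image of
-- S₀ under an automorphism, so every automorphism-invariant X ⊆ G* meets all parts equally often:
-- k ∣ |X|, while |G| = 1 + k |S₀|.  Take for X the elements g with g^L ≠ 1, where |U| ∣ L (so U^L = 1
-- by Lagrange) and L = K Nq with N = Nq q, where N is the order of z in the semidirect factor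
-- M ⋊ ⟨z⟩ and q = 2, or q = 3 in type 3.  If the exponent of M divides K and q ∤ K, which the
-- coprimality hypotheses allow, then (zⁱ x)^L = 1 exactly when q ∣ i.  Hence X has density 1/2, or
-- density 2/3 with L even; in the latter case X ∩ S₀ is a union of pairs {g, g⁻¹}, so even
-- 2k ∣ |X|.  Either way k ∣ |G|, forcing k = 1.

module Submission where

open import Defs
open import Level using (Level; 0ℓ)
open import Data.Nat
  using (ℕ; zero; suc; _+_; _*_; _∸_; _^_; _%_; _≤_; s≤s; z≤n; NonZero; >-nonZero⁻¹)
open import Data.Nat.Properties
  using (+-assoc; +-comm; +-identityʳ; *-assoc; *-comm; *-zeroʳ; *-identityʳ; *-identityˡ; ≤-refl;
         1+n≢0; suc-injective; m*n≢0; m*n≢0⇒m≢0; m^n≢0; +-0-commutativeMonoid; *-commutativeSemigroup)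
open import Data.Nat.DivMod using (%-distribˡ-+; m%n%n≡m%n; m*n%n≡0)
open import Data.Nat.Divisibility
open import Data.Nat.GCD using (gcd; gcd-comm)
open import Data.Nat.Coprimality using (gcd≡1⇒coprime)
open import Data.Nat.Primality using (Prime; prime?; prime[2]; ¬prime[1]; euclidsLemma)
open import Data.Nat.Tactic.RingSolver using (solve-∀)
open import Data.Fin using (Fin; zero; suc; toℕ; fromℕ<; _↑ˡ_; _↑ʳ_; combine; remQuot; _<_; _<?_)
open import Data.Fin.Properties
  using (_≟_; toℕ-fromℕ<; toℕ-injective; toℕ-combine; remQuot-combine; *↔×; <-cmp)
import Data.Fin.Properties as Finₚ
open import Data.Fin.Permutation using (↔⇒≡)
open import Data.Fin.Subset using (_∈_)
open import Data.Fin.Subset.Properties using (_∈?_)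
open import Data.Product using (∃-syntax; _×_; _,_; proj₁; proj₂)
open import Data.Product.Algebra using (×-comm)
open import Data.Product.Function.NonDependent.Propositional using (_×-↔_)
open import Data.Sum using (_⊎_; inj₁; inj₂; [_,_]′)
open import Data.Empty using (⊥-elim)
open import Relation.Nullary using (Dec; yes; no; ¬_)
open import Relation.Nullary.Decidable using (_×-dec_; ¬?; decidable-stable; from-yes; from-no)
open import Relation.Unary using (Pred; Decidable)
open import Relation.Binary using (tri<; tri≈; tri>)
open import Relation.Binary.PropositionalEquality
open import Function using (_∘_; id; const)
open import Function.Bundles using (_⇔_; mk⇔; Equivalence; _↔_; Inverse; mk⤖; mk↔ₛ′)
open import Function.Definitions using (Injective)
open import Function.Properties.Bijection using (⤖⇒↔)
open import Function.Construct.Composition using (_↔-∘_; _⇔-∘_)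
open import Function.Construct.Symmetry using (↔-sym)
open import Function.Construct.Identity using (⇔-id)
open import Function.Related.TypeIsomorphisms using (¬-cong-⇔)
open import Algebra.Bundles using (Group; CommutativeMonoid)
open import Algebra.Structures using (IsGroup)
import Algebra.Properties.Group as GroupProperties
import Algebra.Properties.CommutativeMonoid.Sum as Sum

open Sum +-0-commutativeMonoid using (sum; sum-permute; ∑-comm; ∑-distrib-+; sum-cong-≗)
open import Algebra.Properties.CommutativeSemigroup *-commutativeSemigroup using (x∙yz≈y∙xz)

private
  variable
    ℓ ℓ′ : Level
    A B : Set ℓ
    a b n p : ℕ

indicator : Dec A → ℕ
indicator (yes _) = 1
indicator (no _)  = 0

indicator-yes : A → (a? : Dec A) → indicator a? ≡ 1
indicator-yes a (yes _) = refl
indicator-yes a (no ¬a) = ⊥-elim (¬a a)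

indicator-no : ¬ A → (a? : Dec A) → indicator a? ≡ 0
indicator-no ¬a (yes a) = ⊥-elim (¬a a)
indicator-no ¬a (no _)  = refl

indicator-cong : A ⇔ B → (a? : Dec A) (b? : Dec B) → indicator a? ≡ indicator b?
indicator-cong A⇔B (yes a) b? = sym (indicator-yes (Equivalence.to A⇔B a) b?)
indicator-cong A⇔B (no ¬a) b? = sym (indicator-no (¬a ∘ Equivalence.from A⇔B) b?)

count : {P : Pred (Fin n) ℓ} → Decidable P → ℕ
count P? = sum (λ i → indicator (P? i))

sum-const : ∀ n c → sum {n} (const c) ≡ n * c
sum-const zero    c = refl
sum-const (suc n) c = cong (c +_) (sum-const n c)

sum-++ : ∀ a {b} (f : Fin (a + b) → ℕ) →
         sum f ≡ sum (λ i → f (i ↑ˡ b)) + sum (λ j → f (a ↑ʳ j))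
sum-++ zero    f = refl
sum-++ (suc a) f = trans (cong (f zero +_) (sum-++ a (f ∘ suc))) (sym (+-assoc (f zero) _ _))

sum-combine : ∀ a {b} (f : Fin (a * b) → ℕ) →
              sum f ≡ sum {a} (λ i → sum {b} (λ j → f (combine i j)))
sum-combine zero        f = refl
sum-combine (suc a) {b} f =
  trans (sum-++ b f) (cong (sum (λ j → f (j ↑ˡ (a * b))) +_) (sum-combine a (f ∘ (b ↑ʳ_))))

module _ {P : Pred (Fin n) ℓ} (P? : Decidable P) where

  count-cong : {Q : Pred (Fin n) ℓ′} (Q? : Decidable Q) → (∀ i → P i ⇔ Q i) → count P? ≡ count Q?
  count-cong Q? P⇔Q = sum-cong-≗ (λ i → indicator-cong (P⇔Q i) (P? i) (Q? i))

  count-none : (∀ i → ¬ P i) → count P? ≡ 0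
  count-none ¬P =
    trans (sum-cong-≗ (λ i → indicator-no (¬P i) (P? i))) (trans (sum-const n 0) (*-zeroʳ n))

  count-all : (∀ i → P i) → count P? ≡ n
  count-all all =
    trans (sum-cong-≗ (λ i → indicator-yes (all i) (P? i))) (trans (sum-const n 1) (*-identityʳ n))

  count-¬ : count (¬? ∘ P?) + count P? ≡ n
  count-¬ = begin
    count (¬? ∘ P?) + count P?
      ≡⟨ ∑-distrib-+ (indicator ∘ ¬? ∘ P?) (indicator ∘ P?) ⟨
    sum (λ i → indicator (¬? (P? i)) + indicator (P? i))  ≡⟨ sum-cong-≗ one ⟩
    sum {n} (const 1)                                     ≡⟨ sum-const n 1 ⟩
    n * 1                                                 ≡⟨ *-identityʳ n ⟩
    n                                                     ∎
    where
    open ≡-Reasoning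
    one : ∀ i → indicator (¬? (P? i)) + indicator (P? i) ≡ 1
    one i with P? i
    ... | yes _ = refl
    ... | no _  = refl

  count-↔ : (π : Fin a ↔ Fin n) → count P? ≡ count (P? ∘ Inverse.to π)
  count-↔ π = sum-permute (λ i → indicator (P? i)) π

count-unique : {P : Pred (Fin n) ℓ} (P? : Decidable P) {j : Fin n} →
               P j → (∀ i → P i → i ≡ j) → count P? ≡ 1
count-unique P? {zero}  Pj unique = cong₂ _+_
  (indicator-yes Pj (P? zero))
  (count-none (P? ∘ suc) (λ i Pi → Finₚ.0≢1+n (sym (unique (suc i) Pi))))
count-unique P? {suc j} Pj unique = cong₂ _+_
  (indicator-no (λ P0 → Finₚ.0≢1+n (unique zero P0)) (P? zero))
  (count-unique (P? ∘ suc) Pj (λ i Pi → Finₚ.suc-injective (unique (suc i) Pi)))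

count-even : {P : Pred (Fin n) ℓ} (P? : Decidable P) (ι : Fin n → Fin n) →
             (∀ i → ι (ι i) ≡ i) → (∀ i → P i → P (ι i)) → (∀ i → P i → i ≢ ι i) → 2 ∣ count P?
count-even {P = P} P? ι involutive P-ι fixed-point-free =
  divides (count below?) (begin
    count P?                          ≡⟨ count-split ⟩
    count below? + count above?       ≡⟨ cong (count below? +_) above≡below ⟩
    count below? + count below?       ≡⟨ cong (count below? +_) (+-identityʳ _) ⟨
    2 * count below?                  ≡⟨ *-comm 2 (count below?) ⟩
    count below? * 2                  ∎)
  where
  open ≡-Reasoning
  below? above? : Decidable (λ i → P i × _)
  below? i = P? i ×-dec (i <? ι i)
  above? i = P? i ×-dec (ι i <? i)

  split : ∀ i → indicator (P? i) ≡ indicator (below? i) + indicator (above? i)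
  split i with <-cmp i (ι i)
  ... | tri< i<ιi _ ιi≮i = sym (trans
    (cong₂ _+_ (indicator-cong (mk⇔ proj₁ (_, i<ιi)) (below? i) (P? i))
               (indicator-no (ιi≮i ∘ proj₂) (above? i)))
    (+-identityʳ _))
  ... | tri≈ _ i≡ιi _ = trans (indicator-no (λ Pi → fixed-point-free i Pi i≡ιi) (P? i))
    (sym (cong₂ _+_ (indicator-no (λ (Pi , _) → fixed-point-free i Pi i≡ιi) (below? i))
                    (indicator-no (λ (Pi , _) → fixed-point-free i Pi i≡ιi) (above? i))))
  ... | tri> i≮ιi _ ιi<i = sym
    (cong₂ _+_ (indicator-no (i≮ιi ∘ proj₂) (below? i))
               (indicator-cong (mk⇔ proj₁ (_, ιi<i)) (above? i) (P? i)))

  count-split : count P? ≡ count below? + count above?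
  count-split = trans (sum-cong-≗ split) (∑-distrib-+ (indicator ∘ below?) (indicator ∘ above?))

  above≡below : count above? ≡ count below?
  above≡below = trans (count-↔ above? (mk↔ₛ′ ι ι involutive involutive))
    (count-cong _ below? (λ i → mk⇔
      (λ (Pιi , ιιi<ιi) → subst P (involutive i) (P-ι _ Pιi) , subst (_< ι i) (involutive i) ιιi<ιi)
      (λ (Pi , i<ιi) → P-ι i Pi , subst (_< ι i) (sym (involutive i)) i<ιi)))

count-↔× : {P : Pred (Fin n) ℓ} (P? : Decidable P) (π : (Fin a × Fin b) ↔ Fin n) →
           count P? ≡ sum {a} (λ i → sum {b} (λ j → indicator (P? (Inverse.to π (i , j)))))
count-↔× {a = a} {b = b} P? π = begin
  count P?                                     ≡⟨ count-↔ P? (π ↔-∘ *↔× {a} {b}) ⟩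
  count (P? ∘ Inverse.to (π ↔-∘ *↔× {a} {b}))  ≡⟨ sum-combine a {b} _ ⟩
  sum {a} (λ i → sum {b} (λ j → indicator (P? (Inverse.to π (remQuot b (combine i j))))))
    ≡⟨ sum-cong-≗ (λ i → sum-cong-≗ (λ j →
         cong (indicator ∘ P? ∘ Inverse.to π) (remQuot-combine i j))) ⟩
  sum {a} (λ i → sum {b} (λ j → indicator (P? (Inverse.to π (i , j))))) ∎
  where open ≡-Reasoning

×↔⇒≡* : (Fin a × Fin b) ↔ Fin n → a * b ≡ n
×↔⇒≡* {a} {b} π = ↔⇒≡ (π ↔-∘ *↔× {a} {b})

HasDensity : ∀ (p : ℕ) {n} {P : Pred (Fin n) ℓ} → Decidable P → Set
HasDensity p {n} P? = suc p * count P? ≡ p * n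

module _ {P : Pred (Fin n) ℓ} (P? : Decidable P) where

  density-fibreˡ : (π : (Fin a × Fin b) ↔ Fin n) {Q : Pred (Fin a) ℓ′} (Q? : Decidable Q) →
                   (∀ i j → P (Inverse.to π (i , j)) ⇔ Q i) → HasDensity p Q? → HasDensity p P?
  density-fibreˡ {a = a} {b = b} {p = p} π Q? P⇔Q Q-density = begin
    suc p * count P?        ≡⟨ cong (suc p *_) count-P ⟩
    suc p * (b * count Q?)  ≡⟨ x∙yz≈y∙xz (suc p) b (count Q?) ⟩
    b * (suc p * count Q?)  ≡⟨ cong (b *_) Q-density ⟩
    b * (p * a)             ≡⟨ x∙yz≈y∙xz b p a ⟩
    p * (b * a)             ≡⟨ cong (p *_) (trans (*-comm b a) (×↔⇒≡* π)) ⟩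
    p * n                   ∎
    where
    open ≡-Reasoning
    count-P : count P? ≡ b * count Q?
    count-P = begin
      count P?                                          ≡⟨ count-↔× P? π ⟩
      sum {a} (λ i → sum {b} (λ j → indicator (P? (Inverse.to π (i , j)))))
        ≡⟨ sum-cong-≗ (λ i → sum-cong-≗ (λ j → indicator-cong (P⇔Q i j) _ (Q? i))) ⟩
      sum {a} (λ i → sum {b} (λ _ → indicator (Q? i)))
        ≡⟨ ∑-comm {a} {b} (λ i _ → indicator (Q? i)) ⟩
      sum {b} (λ _ → count Q?)                          ≡⟨ sum-const b _ ⟩
      b * count Q?                                      ∎

  density-fibreʳ : (π : (Fin a × Fin b) ↔ Fin n) {Q : Pred (Fin b) ℓ′} (Q? : Decidable Q) →
                   (∀ i j → P (Inverse.to π (i , j)) ⇔ Q j) → HasDensity p Q? → HasDensity p P?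
  density-fibreʳ {p = p} π Q? P⇔Q =
    density-fibreˡ {p = p} (π ↔-∘ ×-comm _ _) Q? (λ j i → P⇔Q i j)

count-nondivisible : ∀ p → count (λ (j : Fin (suc p)) → ¬? (suc p ∣? toℕ j)) ≡ p
count-nondivisible p = cong₂ _+_
  (indicator-no (λ q∤0 → q∤0 (suc p ∣0)) (¬? (suc p ∣? 0)))
  (count-all (λ j → ¬? (suc p ∣? suc (toℕ j))) (λ j → >⇒∤ (s≤s (Finₚ.toℕ<n j))))

density-nondivisible : ∀ {N} Nq → N ≡ Nq * suc p →
                       HasDensity p (λ (i : Fin N) → ¬? (suc p ∣? toℕ i))
density-nondivisible {p} Nq refl =
  density-fibreʳ (λ i → ¬? (suc p ∣? toℕ i)) {p = p} (↔-sym (*↔× {Nq}))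
    (λ j → ¬? (suc p ∣? toℕ j))
    (λ i j → ¬-cong-⇔ (nondivisibility i j))
    (trans (cong (suc p *_) (count-nondivisible p)) (*-comm (suc p) p))
  where
  nondivisibility : ∀ i j → suc p ∣ toℕ (combine {Nq} i j) ⇔ suc p ∣ toℕ j
  nondivisibility i j = mk⇔
    (λ q∣ij → ∣m+n∣m⇒∣n (subst (suc p ∣_) (toℕ-combine i j) q∣ij) (m∣m*n (toℕ i)))
    (λ q∣j → subst (suc p ∣_) (sym (toℕ-combine i j)) (∣m∣n⇒∣m+n (m∣m*n (toℕ i)) q∣j))

power : (A → A → A) → A → A → ℕ → A
power _·_ e x zero    = e
power _·_ e x (suc n) = x · power _·_ e x n

power-prodMul : (μ : A → A → A) (ν : B → B → B) (e : A) (e′ : B) → ∀ x y n →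
                power (prodMul μ ν) (e , e′) (x , y) n ≡ (power μ e x n , power ν e′ y n)
power-prodMul μ ν e e′ x y zero    = refl
power-prodMul μ ν e e′ x y (suc n) = cong (prodMul μ ν (x , y)) (power-prodMul μ ν e e′ x y n)

module FinGroupProperties (G : FinGroup) where
  open FinGroup G
  open IsGroup isGroup using (assoc; identityˡ; identityʳ; isMonoid)

  group : Group 0ℓ 0ℓ
  group = record { isGroup = isGroup }

  open GroupProperties group public
    using (⁻¹-involutive; ⁻¹-injective; ⁻¹-anti-homo-∙; ε⁻¹≈ε; identityˡ-unique;
           \\-leftDividesˡ; \\-leftDividesʳ)

  idempotent⇒ε : ∀ {x} → x ∙ x ≡ x → x ≡ ε
  idempotent⇒ε {x} = identityˡ-unique x x

  power-∙ : ∀ x n → power _∙_ ε x n ≡ pow G x n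
  power-∙ x zero    = refl
  power-∙ x (suc n) = cong (x ∙_) (power-∙ x n)

  pow-+ : ∀ x m n → pow G x (m + n) ≡ pow G x m ∙ pow G x n
  pow-+ x zero    n = sym (identityˡ _)
  pow-+ x (suc m) n = trans (cong (x ∙_) (pow-+ x m n)) (sym (assoc _ _ _))

  pow-ε : ∀ n → pow G ε n ≡ ε
  pow-ε zero    = refl
  pow-ε (suc n) = trans (identityˡ _) (pow-ε n)

  pow-* : ∀ x m n → pow G x (m * n) ≡ pow G (pow G x n) m
  pow-* x zero    n = refl
  pow-* x (suc m) n = trans (pow-+ x n (m * n)) (cong (pow G x n ∙_) (pow-* x m n))

  pow-∣ : ∀ {x m n} → pow G x m ≡ ε → m ∣ n → pow G x n ≡ ε
  pow-∣ {x} {m} x^m≡ε (divides q refl) =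
    trans (pow-* x q m) (trans (cong (λ y → pow G y q) x^m≡ε) (pow-ε q))

  pow-comm : ∀ x n → x ∙ pow G x n ≡ pow G x n ∙ x
  pow-comm x n = begin
    pow G x (1 + n)      ≡⟨ cong (pow G x) (+-comm 1 n) ⟩
    pow G x (n + 1)      ≡⟨ pow-+ x n 1 ⟩
    pow G x n ∙ (x ∙ ε)  ≡⟨ cong (pow G x n ∙_) (identityʳ x) ⟩
    pow G x n ∙ x        ∎
    where open ≡-Reasoning

  pow-⁻¹ : ∀ x n → pow G (x ⁻¹) n ≡ (pow G x n) ⁻¹
  pow-⁻¹ x zero    = sym ε⁻¹≈ε
  pow-⁻¹ x (suc n) = begin
    (x ⁻¹) ∙ pow G (x ⁻¹) n    ≡⟨ cong ((x ⁻¹) ∙_) (pow-⁻¹ x n) ⟩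
    (x ⁻¹) ∙ ((pow G x n) ⁻¹)  ≡⟨ ⁻¹-anti-homo-∙ (pow G x n) x ⟨
    (pow G x n ∙ x) ⁻¹         ≡⟨ cong _⁻¹ (pow-comm x n) ⟨
    (x ∙ pow G x n) ⁻¹         ∎
    where open ≡-Reasoning

  module _ (comm : IsAbelian G) where

    commutativeMonoid : CommutativeMonoid 0ℓ 0ℓ
    commutativeMonoid = record
      { isCommutativeMonoid = record { isMonoid = isMonoid ; comm = comm } }

    private
      module Π = Sum commutativeMonoid

      product-const : ∀ x n → Π.sum {n} (const x) ≡ pow G x n
      product-const x zero    = refl
      product-const x (suc n) = cong (x ∙_) (product-const x n)

    -- Multiplying every element by x permutes G, so the product of all elements is unchanged.
    lagrange : ∀ x → pow G x order ≡ ε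
    lagrange x = identityˡ-unique (pow G x order) (Π.sum id) (sym (begin
      Π.sum id                            ≡⟨ Π.sum-permute id translation ⟩
      Π.sum (x ∙_)                        ≡⟨ Π.∑-distrib-+ {order} (const x) id ⟩
      Π.sum {order} (const x) ∙ Π.sum id  ≡⟨ cong (_∙ Π.sum id) (product-const x order) ⟩
      pow G x order ∙ Π.sum id            ∎))
      where
      open ≡-Reasoning
      translation : Fin order ↔ Fin order
      translation = mk↔ₛ′ (x ∙_) ((x ⁻¹) ∙_) (\\-leftDividesˡ x) (\\-leftDividesʳ x)

record IsEmbedding {A : Set} (μ : A → A → A) (G : FinGroup)
                   (φ : A → Fin (FinGroup.order G)) : Set where
  field
    injective   : Injective _≡_ _≡_ φ
    homomorphic : ∀ x y → φ (μ x y) ≡ FinGroup._∙_ G (φ x) (φ y)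

isoTo⇒embedding : ∀ {A : Set} {μ G} (iso : IsoTo A μ G) → IsEmbedding μ G (proj₁ iso)
isoTo⇒embedding (_ , (injective , _) , homomorphic) =
  record { injective = injective ; homomorphic = homomorphic }

aut⇒embedding : ∀ {G α} → IsAut G α → IsEmbedding (FinGroup._∙_ G) G α
aut⇒embedding ((injective , _) , homomorphic) =
  record { injective = injective ; homomorphic = homomorphic }

isoTo⇒↔ : ∀ {A : Set} {μ G} → IsoTo A μ G → A ↔ Fin (FinGroup.order G)
isoTo⇒↔ (_ , bijective , _) = ⤖⇒↔ (mk⤖ bijective)

module Embedding (G : FinGroup) {A : Set} {μ : A → A → A} {φ : A → Fin (FinGroup.order G)}
                 (embedding : IsEmbedding μ G φ) {e : A} (e-idem : μ e e ≡ e) where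
  open FinGroup G
  open FinGroupProperties G
  open IsEmbedding embedding

  φ-e : φ e ≡ ε
  φ-e = idempotent⇒ε (trans (sym (homomorphic e e)) (cong φ e-idem))

  φ-power : ∀ x n → φ (power μ e x n) ≡ pow G (φ x) n
  φ-power x zero    = φ-e
  φ-power x (suc n) = trans (homomorphic x _) (cong (φ x ∙_) (φ-power x n))

  power-* : ∀ x m n → power μ e x (m * n) ≡ power μ e (power μ e x n) m
  power-* x m n = injective (begin
    φ (power μ e x (m * n))            ≡⟨ φ-power x (m * n) ⟩
    pow G (φ x) (m * n)                ≡⟨ pow-* (φ x) m n ⟩
    pow G (pow G (φ x) n) m            ≡⟨ cong (λ y → pow G y m) (φ-power x n) ⟨
    pow G (φ (power μ e x n)) m        ≡⟨ φ-power (power μ e x n) m ⟨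
    φ (power μ e (power μ e x n) m)    ∎)
    where open ≡-Reasoning

  pow≡ε⇔power≡e : ∀ x n → pow G (φ x) n ≡ ε ⇔ power μ e x n ≡ e
  pow≡ε⇔power≡e x n = mk⇔
    (λ eq → injective (trans (φ-power x n) (trans eq (sym φ-e))))
    (λ eq → trans (sym (φ-power x n)) (trans (cong φ eq) φ-e))

embedding-fst : ∀ {A B : Set} {μ : A → A → A} {ν : B → B → B} {G φ} → IsEmbedding (prodMul μ ν) G φ →
                ∀ {e} → ν e e ≡ e → IsEmbedding μ G (λ x → φ (x , e))
embedding-fst {μ = μ} {φ = φ} embedding {e} e-idem = record
  { injective   = λ eq → cong proj₁ (injective eq)
  ; homomorphic = λ x y →
      trans (cong (λ z → φ (μ x y , z)) (sym e-idem)) (homomorphic (x , e) (y , e))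
  }
  where open IsEmbedding embedding

embedding-snd : ∀ {A B : Set} {μ : A → A → A} {ν : B → B → B} {G φ} → IsEmbedding (prodMul μ ν) G φ →
                ∀ {e} → μ e e ≡ e → IsEmbedding ν G (λ y → φ (e , y))
embedding-snd {ν = ν} {φ = φ} embedding {e} e-idem = record
  { injective   = λ eq → cong proj₂ (injective eq)
  ; homomorphic = λ x y →
      trans (cong (λ z → φ (z , ν x y)) (sym e-idem)) (homomorphic (e , x) (e , y))
  }
  where open IsEmbedding embedding

NontrivialPower : (G : FinGroup) → ℕ → Pred (Fin (FinGroup.order G)) 0ℓ
NontrivialPower G L g = pow G g L ≢ FinGroup.ε G

nontrivialPower? : (G : FinGroup) (L : ℕ) → Decidable (NontrivialPower G L)
nontrivialPower? G L g = ¬? (pow G g L ≟ FinGroup.ε G)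

AutInvariant : (G : FinGroup) → Pred (Fin (FinGroup.order G)) ℓ → Set ℓ
AutInvariant G P = ∀ {α} → IsAut G α → ∀ g → P (α g) ⇔ P g

module _ (G : FinGroup) where
  open FinGroup G
  open IsGroup isGroup using (identityˡ; identityʳ; inverseʳ)
  open FinGroupProperties G

  nontrivialPower-autInvariant : ∀ L → AutInvariant G (NontrivialPower G L)
  nontrivialPower-autInvariant L {α} aut g = ¬-cong-⇔
    (subst (λ y → (pow G (α g) L ≡ ε) ⇔ (y ≡ ε)) (power-∙ g L) (pow≡ε⇔power≡e g L))
    where open Embedding G (aut⇒embedding aut) (identityˡ ε)

  ≢ε-autInvariant : AutInvariant G (_≢ ε)
  ≢ε-autInvariant {α} aut g = mk⇔
    (λ αg≢ε g≡ε → αg≢ε (trans (cong α g≡ε) φ-e))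
    (λ g≢ε αg≡ε → g≢ε (proj₁ (proj₁ aut) (trans αg≡ε (sym φ-e))))
    where open Embedding G (aut⇒embedding aut) (identityˡ ε)

  nontrivialPower-ε : ∀ L → ¬ NontrivialPower G L ε
  nontrivialPower-ε L ε^L≢ε = ε^L≢ε (pow-ε L)

  nontrivialPower-⁻¹ : ∀ {L g} → NontrivialPower G L g → NontrivialPower G L (g ⁻¹)
  nontrivialPower-⁻¹ {L} {g} g^L≢ε g⁻¹^L≡ε =
    g^L≢ε (⁻¹-injective (trans (sym (pow-⁻¹ g L)) (trans g⁻¹^L≡ε (sym ε⁻¹≈ε))))

  nontrivialPower⇒≢⁻¹ : ∀ {L g} → 2 ∣ L → NontrivialPower G L g → g ≢ g ⁻¹
  nontrivialPower⇒≢⁻¹ {L} {g} 2∣L g^L≢ε g≡g⁻¹ = g^L≢ε (pow-∣ g²≡ε 2∣L)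
    where
    g²≡ε : pow G g 2 ≡ ε
    g²≡ε = trans (cong (g ∙_) (trans (identityʳ g) g≡g⁻¹)) (inverseʳ g)

module _ {G U V : FinGroup} (dp : IsDirectProductOf G U V) where
  private
    module U = FinGroup U
    module V = FinGroup V
    e-idem : prodMul U._∙_ V._∙_ (U.ε , V.ε) (U.ε , V.ε) ≡ (U.ε , V.ε)
    e-idem = cong₂ _,_ (IsGroup.identityˡ U.isGroup U.ε) (IsGroup.identityˡ V.isGroup V.ε)
  open Embedding G (isoTo⇒embedding dp) e-idem

  directProduct-pow≡ε : ∀ u v n →
    pow G (proj₁ dp (u , v)) n ≡ FinGroup.ε G ⇔ (pow U u n ≡ U.ε × pow V v n ≡ V.ε)
  directProduct-pow≡ε u v n = mk⇔
    (λ eq → let uv = trans (sym powers) (Equivalence.to (pow≡ε⇔power≡e (u , v) n) eq)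
            in cong proj₁ uv , cong proj₂ uv)
    (λ (u^n≡ε , v^n≡ε) →
      Equivalence.from (pow≡ε⇔power≡e (u , v) n) (trans powers (cong₂ _,_ u^n≡ε v^n≡ε)))
    where
    powers : power (prodMul U._∙_ V._∙_) (U.ε , V.ε) (u , v) n ≡ (pow U u n , pow V v n)
    powers = trans (power-prodMul U._∙_ V._∙_ U.ε V.ε u v n)
                   (cong₂ _,_ (FinGroupProperties.power-∙ U u n) (FinGroupProperties.power-∙ V v n))

  density-directProduct : ∀ {L p} → (∀ u → pow U u L ≡ U.ε) →
    HasDensity p (nontrivialPower? V L) → HasDensity p (nontrivialPower? G L)
  density-directProduct {L} {p} U^L≡ε =
    density-fibreʳ (nontrivialPower? G L) {p = p} (isoTo⇒↔ {μ = prodMul U._∙_ V._∙_} {G} dp)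
      (nontrivialPower? V L) (λ u v → ¬-cong-⇔ (mk⇔ proj₂ (U^L≡ε u ,_) ⇔-∘ directProduct-pow≡ε u v L))

-- k-if partitions of CI-groups

module _ {G : FinGroup} (ci : IsCIGroup G) where
  open FinGroup G
  open FinGroupProperties G using (⁻¹-involutive)

  cayIso-count : ∀ {S T} → InvClosed G S → InvClosed G T → CayIso G S T →
                 {P : Pred (Fin order) ℓ} (P? : Decidable P) → AutInvariant G P →
                 count (λ g → g ∈? T ×-dec P? g) ≡ count (λ g → g ∈? S ×-dec P? g)
  cayIso-count {S = S} {T = T} S-inv T-inv S≅T P? P-inv with ci S T S-inv T-inv S≅T
  ... | α , aut@(bijective , _) , T≡αS =
    trans (count-↔ T∩P? (⤖⇒↔ (mk⤖ bijective))) (count-cong (T∩P? ∘ α) S∩P? (λ g → mk⇔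
      (λ (αg∈T , Pαg) → preimage g αg∈T , Equivalence.to (P-inv aut g) Pαg)
      (λ (g∈S , Pg) →
        Equivalence.from (T≡αS (α g)) (g , g∈S , refl) , Equivalence.from (P-inv aut g) Pg)))
    where
    T∩P? S∩P? : Decidable _
    T∩P? g = g ∈? T ×-dec P? g
    S∩P? g = g ∈? S ×-dec P? g
    preimage : ∀ g → α g ∈ T → g ∈ S
    preimage g αg∈T with Equivalence.to (T≡αS (α g)) αg∈T
    ... | h , h∈S , αh≡αg = subst (_∈ S) (proj₁ bijective αh≡αg) h∈S

  kif-count : ∀ {k S} → IsKIfCayley G (suc k) S →
              {P : Pred (Fin order) ℓ} (P? : Decidable P) → AutInvariant G P → ¬ P ε →
              count P? ≡ suc k * count (λ g → g ∈? S ×-dec P? g)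
  kif-count {k = k} (Part , refl , _ , disjoint , covers , invClosed , cayIso) {P} P? P-inv ¬Pε = begin
    count P?                                                      ≡⟨ sum-cong-≗ in-one-part ⟩
    sum (λ g → count (λ j → g ∈? Part j ×-dec P? g))
      ≡⟨ ∑-comm {order} {suc k} (λ g j → indicator (g ∈? Part j ×-dec P? g)) ⟩
    sum (λ j → count (λ g → g ∈? Part j ×-dec P? g))              ≡⟨ sum-cong-≗ part≡S ⟩
    sum {suc k} (λ _ → count (λ g → g ∈? Part zero ×-dec P? g))  ≡⟨ sum-const (suc k) _ ⟩
    suc k * count (λ g → g ∈? Part zero ×-dec P? g)               ∎
    where
    open ≡-Reasoning
    in-one-part : ∀ g → indicator (P? g) ≡ count (λ j → g ∈? Part j ×-dec P? g)
    in-one-part g with P? g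
    ... | no ¬Pg = sym (count-none (λ j → g ∈? Part j ×-dec no ¬Pg) (λ _ → ¬Pg ∘ proj₂))
    ... | yes Pg with covers g (λ g≡ε → ¬Pε (subst P g≡ε Pg))
    ...   | j , g∈j = sym (count-unique (λ i → g ∈? Part i ×-dec yes Pg) (g∈j , Pg)
              (λ i (g∈i , _) → decidable-stable (i ≟ j) (λ i≢j → disjoint i j i≢j g g∈i g∈j)))
    part≡S : ∀ j → count (λ g → g ∈? Part j ×-dec P? g) ≡ count (λ g → g ∈? Part zero ×-dec P? g)
    part≡S j = sym (cayIso-count (invClosed j) (invClosed zero) (cayIso j) P? P-inv)

  kif-order : ∀ {k S} → IsKIfCayley G (suc k) S →
              order ≡ suc (suc k * count (λ g → g ∈? S ×-dec ¬? (g ≟ ε)))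
  kif-order {k} {S} kif = begin
    order                                              ≡⟨ count-¬ (_≟ ε) ⟨
    count (λ g → ¬? (g ≟ ε)) + count (_≟ ε)            ≡⟨ cong₂ _+_ non-identity identity ⟩
    suc k * count (λ g → g ∈? S ×-dec ¬? (g ≟ ε)) + 1  ≡⟨ +-comm _ 1 ⟩
    suc (suc k * count (λ g → g ∈? S ×-dec ¬? (g ≟ ε)))  ∎
    where
    open ≡-Reasoning
    non-identity : count (λ g → ¬? (g ≟ ε)) ≡ suc k * count (λ g → g ∈? S ×-dec ¬? (g ≟ ε))
    non-identity = kif-count kif (λ g → ¬? (g ≟ ε)) (≢ε-autInvariant G) (λ ε≢ε → ε≢ε refl)
    identity : count (_≟ ε) ≡ 1
    identity = count-unique (_≟ ε) refl (λ _ → id)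

  kif-parts∣order⇒k≡0 : ∀ {k S} → IsKIfCayley G (suc k) S → suc k ∣ order → k ≡ 0
  kif-parts∣order⇒k≡0 {k} kif k+1∣order = suc-injective (∣1⇒≡1 (∣m+n∣m⇒∣n
    (subst (suc k ∣_) (trans (kif-order kif) (+-comm 1 _)) k+1∣order) (m∣m*n _)))

  kif-parts∣count : ∀ {k S} → IsKIfCayley G (suc k) S → ∀ L → suc k ∣ count (nontrivialPower? G L)
  kif-parts∣count kif L = subst (_ ∣_)
    (sym (kif-count kif (nontrivialPower? G L) (nontrivialPower-autInvariant G L) (nontrivialPower-ε G L)))
    (m∣m*n _)

  kif-half-density⇒k≡0 : ∀ {k S L} → IsKIfCayley G (suc k) S →
                         HasDensity 1 (nontrivialPower? G L) → k ≡ 0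
  kif-half-density⇒k≡0 {L = L} kif half = kif-parts∣order⇒k≡0 kif
    (subst (_ ∣_) (trans half (*-identityˡ order)) (∣n⇒∣m*n 2 (kif-parts∣count kif L)))

  kif-two-thirds-density⇒k≡0 : ∀ {k S L} → IsKIfCayley G (suc k) S → 2 ∣ L →
                               HasDensity 2 (nontrivialPower? G L) → k ≡ 0
  kif-two-thirds-density⇒k≡0 {k} {L = L} kif@(Part , refl , _ , _ , _ , invClosed , _) 2∣L two-thirds =
    kif-parts∣order⇒k≡0 kif (*-cancelʳ-∣ 2
      (subst (suc k * 2 ∣_) (trans two-thirds (*-comm 2 order)) (∣n⇒∣m*n 3 2[k+1]∣count)))
    where
    X? : Decidable (NontrivialPower G L)
    X? = nontrivialPower? G L
    S∩X-even : 2 ∣ count (λ g → g ∈? Part zero ×-dec X? g)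
    S∩X-even = count-even _ _⁻¹ ⁻¹-involutive
      (λ g (g∈S , Xg) → proj₂ (invClosed zero) g g∈S , nontrivialPower-⁻¹ G {L} Xg)
      (λ g (_ , Xg) → nontrivialPower⇒≢⁻¹ G {L} 2∣L Xg)
    2[k+1]∣count : suc k * 2 ∣ count X?
    2[k+1]∣count = subst (_ ∣_)
      (sym (kif-count kif X? (nontrivialPower-autInvariant G L) (nontrivialPower-ε G L)))
      (*-monoʳ-∣ (suc k) S∩X-even)

-- Powers in the semidirect product M ⋊ Z_N

toℕ-addMod : ∀ {N} .{{_ : NonZero N}} (i j : Fin N) → toℕ (addMod i j) ≡ (toℕ i + toℕ j) % N
toℕ-addMod {suc N} i j = toℕ-fromℕ< _

[m+n%d]%d≡[m+n]%d : ∀ m n d .{{_ : NonZero d}} → (m + n % d) % d ≡ (m + n) % d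
[m+n%d]%d≡[m+n]%d m n d = begin
  (m + n % d) % d          ≡⟨ %-distribˡ-+ m (n % d) d ⟩
  (m % d + n % d % d) % d  ≡⟨ cong (λ x → (m % d + x) % d) (m%n%n≡m%n n d) ⟩
  (m % d + n % d) % d      ≡⟨ %-distribˡ-+ m n d ⟨
  (m + n) % d              ∎
  where open ≡-Reasoning

module SemidirectPowers (M : FinGroup) (N l : ℕ) .{{N≢0 : NonZero N}} where
  open FinGroup M
  open IsGroup isGroup using (identityʳ)
  open FinGroupProperties M using (pow-ε; pow-∣)

  one : Fin N × Fin order
  one = fromℕ< (>-nonZero⁻¹ N) , ε

  toℕ-one : toℕ (proj₁ one) ≡ 0
  toℕ-one = toℕ-fromℕ< _

  ≡one : ∀ {i x} → toℕ i ≡ 0 → x ≡ ε → (i , x) ≡ one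
  ≡one i≡0 refl = cong (_, ε) (toℕ-injective (trans i≡0 (sym toℕ-one)))

  one-idem : semiMul M N l one one ≡ one
  one-idem = ≡one
    (trans (toℕ-addMod _ _) (trans (cong (λ t → (t + t) % N) toℕ-one) (m*n%n≡0 0 N)))
    (trans (identityʳ _) (pow-ε (l ^ toℕ (proj₁ one))))

  powerᴴ : Fin N × Fin order → ℕ → Fin N × Fin order
  powerᴴ = power (semiMul M N l) one

  toℕ-power : ∀ i x n → toℕ (proj₁ (powerᴴ (i , x) n)) ≡ (n * toℕ i) % N
  toℕ-power i x zero    = trans toℕ-one (sym (m*n%n≡0 0 N))
  toℕ-power i x (suc n) = begin
    toℕ (addMod i (proj₁ (powerᴴ (i , x) n)))     ≡⟨ toℕ-addMod i _ ⟩
    (toℕ i + toℕ (proj₁ (powerᴴ (i , x) n))) % N  ≡⟨ cong (λ t → (toℕ i + t) % N) (toℕ-power i x n) ⟩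
    (toℕ i + (n * toℕ i) % N) % N                 ≡⟨ [m+n%d]%d≡[m+n]%d (toℕ i) (n * toℕ i) N ⟩
    (toℕ i + n * toℕ i) % N                       ∎
    where open ≡-Reasoning

  powerᴴ-M : ∀ {i} x n → toℕ i ≡ 0 → powerᴴ (i , x) n ≡ (i , pow M x n)
  powerᴴ-M     x zero    i≡0 = sym (≡one i≡0 refl)
  powerᴴ-M {i} x (suc n) i≡0 =
    trans (cong (semiMul M N l (i , x)) (powerᴴ-M x n i≡0)) (cong₂ _,_ i+i≡i x^l^i∙x^n≡x∙x^n)
    where
    i+i≡i : addMod i i ≡ i
    i+i≡i = toℕ-injective (trans (toℕ-addMod i i)
      (trans (cong (λ t → (t + t) % N) i≡0) (trans (m*n%n≡0 0 N) (sym i≡0))))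
    x^l^i∙x^n≡x∙x^n : pow M x (l ^ toℕ i) ∙ pow M x n ≡ x ∙ pow M x n
    x^l^i∙x^n≡x∙x^n =
      trans (cong (λ t → pow M x (l ^ t) ∙ pow M x n) i≡0) (cong (_∙ pow M x n) (identityʳ x))

  powerᴴ≡one⇒∣ : ∀ {i x} n → powerᴴ (i , x) n ≡ one → N ∣ n * toℕ i
  powerᴴ≡one⇒∣ {i} {x} n eq =
    m%n≡0⇒n∣m _ N (trans (sym (toℕ-power i x n)) (trans (cong (toℕ ∘ proj₁) eq) toℕ-one))

  module _ {G φ} (embedding : IsEmbedding (semiMul M N l) G φ)
           {m} (exponent : ∀ y → pow M y m ≡ ε) where
    open Embedding G embedding one-idem using (power-*)

    powerᴴ≡one⇐ : ∀ {K n i} x → m ∣ K → N ∣ n * toℕ i → powerᴴ (i , x) (K * n) ≡ one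
    powerᴴ≡one⇐ {K} {n} {i} x m∣K N∣ni = begin
      powerᴴ (i , x) (K * n)         ≡⟨ power-* (i , x) K n ⟩
      powerᴴ h K                     ≡⟨ powerᴴ-M (proj₂ h) K h∈M ⟩
      (proj₁ h , pow M (proj₂ h) K)  ≡⟨ ≡one h∈M (pow-∣ (exponent _) m∣K) ⟩
      one                            ∎
      where
      open ≡-Reasoning
      h : Fin N × Fin order
      h = powerᴴ (i , x) n
      h∈M : toℕ (proj₁ h) ≡ 0
      h∈M = trans (toℕ-power i x n) (n∣m⇒m%n≡0 _ N N∣ni)

    powerᴴ-exponent : ∀ {L} h → m * N ∣ L → powerᴴ h L ≡ one
    powerᴴ-exponent (i , x) (divides c refl) = subst (λ t → powerᴴ (i , x) t ≡ one) (*-assoc c m N)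
      (powerᴴ≡one⇐ x (n∣m*n c) (m∣m*n (toℕ i)))

    powerᴴ≡one⇔ : ∀ {Nq p K i} x → N ≡ Nq * suc p → Prime (suc p) → ¬ suc p ∣ K → m ∣ K →
                  powerᴴ (i , x) (K * Nq) ≡ one ⇔ suc p ∣ toℕ i
    powerᴴ≡one⇔ {Nq} {p} {K} {i} x N≡Nq*q q-prime q∤K m∣K = mk⇔ trivial⇒∣ ∣⇒trivial
      where
      instance
        Nq≢0 : NonZero Nq
        Nq≢0 = m*n≢0⇒m≢0 Nq {{subst NonZero N≡Nq*q N≢0}}
      rearrange : K * Nq * toℕ i ≡ Nq * (K * toℕ i)
      rearrange = trans (cong (_* toℕ i) (*-comm K Nq)) (*-assoc Nq K (toℕ i))
      trivial⇒∣ : powerᴴ (i , x) (K * Nq) ≡ one → suc p ∣ toℕ i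
      trivial⇒∣ eq with euclidsLemma K (toℕ i) q-prime
                          (*-cancelˡ-∣ Nq (subst₂ _∣_ N≡Nq*q rearrange (powerᴴ≡one⇒∣ (K * Nq) eq)))
      ... | inj₁ q∣K = ⊥-elim (q∤K q∣K)
      ... | inj₂ q∣i = q∣i
      ∣⇒trivial : suc p ∣ toℕ i → powerᴴ (i , x) (K * Nq) ≡ one
      ∣⇒trivial q∣i = powerᴴ≡one⇐ x m∣K (subst (_∣ Nq * toℕ i) (sym N≡Nq*q) (*-monoʳ-∣ Nq q∣i))

semidirect-density : ∀ {V M N l m Nq p K} .{{_ : NonZero N}} →
  IsoTo (Fin N × Fin (FinGroup.order M)) (semiMul M N l) V →
  (∀ y → pow M y m ≡ FinGroup.ε M) → N ≡ Nq * suc p → Prime (suc p) → ¬ suc p ∣ K → m ∣ K →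
  HasDensity p (nontrivialPower? V (K * Nq))
semidirect-density {V} {M} {N} {l} {m} {Nq} {p} {K} iso exponent N≡Nq*q q-prime q∤K m∣K =
  density-fibreˡ (nontrivialPower? V (K * Nq)) {p = p} (isoTo⇒↔ {μ = semiMul M N l} {V} iso)
    (λ i → ¬? (suc p ∣? toℕ i)) criterion (density-nondivisible Nq N≡Nq*q)
  where
  open SemidirectPowers M N l
  embedding : IsEmbedding (semiMul M N l) V (proj₁ iso)
  embedding = isoTo⇒embedding iso
  open Embedding V embedding one-idem using (pow≡ε⇔power≡e)
  criterion : ∀ i x → NontrivialPower V (K * Nq) (proj₁ iso (i , x)) ⇔ (¬ suc p ∣ toℕ i)
  criterion i x = ¬-cong-⇔ (powerᴴ≡one⇔ embedding {m} exponent x N≡Nq*q q-prime q∤K m∣K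
                              ⇔-∘ pow≡ε⇔power≡e (i , x) (K * Nq))

-- The last hypothesis makes L = K * Nq kill the second factor, so only the first one matters.
semidirect²-density : ∀ {V M M′ N N′ l l′ m m′ Nq p K} .{{_ : NonZero N}} .{{_ : NonZero N′}} →
  IsoTo ((Fin N × Fin (FinGroup.order M)) × (Fin N′ × Fin (FinGroup.order M′)))
        (prodMul (semiMul M N l) (semiMul M′ N′ l′)) V →
  (∀ y → pow M y m ≡ FinGroup.ε M) → (∀ y → pow M′ y m′ ≡ FinGroup.ε M′) →
  N ≡ Nq * suc p → Prime (suc p) → ¬ suc p ∣ K → m ∣ K → m′ * N′ ∣ K * Nq →
  HasDensity p (nontrivialPower? V (K * Nq))
semidirect²-density {V} {M} {M′} {N} {N′} {l} {l′} {m} {m′} {Nq} {p} {K}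
                    iso exponent exponent′ N≡Nq*q q-prime q∤K m∣K m′N′∣L =
  density-fibreˡ (nontrivialPower? V (K * Nq)) {p = p} (isoTo⇒↔ {μ = μ} {V} iso ↔-∘ (*↔× ×-↔ *↔×))
    Q? criterion
    (density-fibreˡ Q? {p = p} (↔-sym *↔×) (λ i → ¬? (suc p ∣? toℕ i)) combine-criterion
      (density-nondivisible Nq N≡Nq*q))
  where
  module H = SemidirectPowers M N l
  module H′ = SemidirectPowers M′ N′ l′
  μ = prodMul (semiMul M N l) (semiMul M′ N′ l′)
  embedding : IsEmbedding μ V (proj₁ iso)
  embedding = isoTo⇒embedding iso
  open Embedding V embedding (cong₂ _,_ H.one-idem H′.one-idem) using (pow≡ε⇔power≡e)

  Q : Pred (Fin (N * FinGroup.order M)) 0ℓ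
  Q c = ¬ suc p ∣ toℕ (proj₁ (remQuot _ c))
  Q? : Decidable Q
  Q? c = ¬? (suc p ∣? toℕ (proj₁ (remQuot _ c)))

  combine-criterion : ∀ i x → Q (combine i x) ⇔ (¬ suc p ∣ toℕ i)
  combine-criterion i x = subst (λ y → (¬ suc p ∣ toℕ (proj₁ y)) ⇔ (¬ suc p ∣ toℕ i))
    (sym (remQuot-combine i x)) (⇔-id _)

  first-factor : ∀ h h′ →
    power μ (H.one , H′.one) (h , h′) (K * Nq) ≡ (H.one , H′.one) ⇔ H.powerᴴ h (K * Nq) ≡ H.one
  first-factor h h′ = mk⇔
    (λ eq → cong proj₁ (trans (sym powers) eq))
    (λ eq → trans powers (cong₂ _,_ eq second-trivial))
    where
    powers = power-prodMul _ _ H.one H′.one h h′ (K * Nq)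
    second-trivial = H′.powerᴴ-exponent (embedding-snd embedding H.one-idem) {m′} exponent′ h′ m′N′∣L

  criterion : ∀ c d → NontrivialPower V (K * Nq) (proj₁ iso (remQuot _ c , remQuot _ d)) ⇔ Q c
  criterion c d = ¬-cong-⇔
    (H.powerᴴ≡one⇔ (embedding-fst embedding H′.one-idem) {m} exponent _ N≡Nq*q q-prime q∤K m∣K
      ⇔-∘ (first-factor (remQuot _ c) (remQuot _ d)
      ⇔-∘ pow≡ε⇔power≡e (remQuot _ c , remQuot _ d) (K * Nq)))

-- Choosing L for the groups of the theorem

DensityObstruction : FinGroup → FinGroup → Set
DensityObstruction U V = ∃[ L ] (FinGroup.order U ∣ L ×
  (HasDensity 1 (nontrivialPower? V L) ⊎ (2 ∣ L × HasDensity 2 (nontrivialPower? V L))))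

kif-obstructed : ∀ {G U V k S} → IsCIGroup G → IsDirectProductOf G U V → IsAbelian U →
                 DensityObstruction U V → IsKIfCayley G (suc k) S → k ≡ 0
kif-obstructed {G} {U} {V} ci dp abelian (L , u∣L , density) kif =
  [ (λ half → kif-half-density⇒k≡0 ci {L = L} kif (inherit {1} half))
  , (λ (2∣L , two-thirds) → kif-two-thirds-density⇒k≡0 ci {L = L} kif 2∣L (inherit {2} two-thirds))
  ]′ density
  where
  open FinGroupProperties U using (pow-∣; lagrange)
  inherit : ∀ {p} → HasDensity p (nontrivialPower? V L) → HasDensity p (nontrivialPower? G L)
  inherit {p} = density-directProduct dp {L} {p} (λ u → pow-∣ (lagrange abelian u) u∣L)

2∣n*[1+n] : ∀ n → 2 ∣ n * suc n
2∣n*[1+n] zero    = 2 ∣0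
2∣n*[1+n] (suc n) = subst (2 ∣_) (expand n) (∣m∣n⇒∣m+n (2∣n*[1+n] n) (m∣m*n (suc n)))
  where
  expand : ∀ n → n * suc n + 2 * suc n ≡ suc n * suc (suc n)
  expand = solve-∀

2∣n*[n∸1] : ∀ n → 2 ∣ n * (n ∸ 1)
2∣n*[n∸1] zero    = 2 ∣0
2∣n*[n∸1] (suc n) = subst (2 ∣_) (*-comm n (suc n)) (2∣n*[1+n] n)

coprime⇒∤ : ∀ {m n p} → gcd m n ≡ 1 → Prime p → p ∣ m → ¬ p ∣ n
coprime⇒∤ gcd≡1 p-prime p∣m p∣n =
  ¬prime[1] (subst Prime (gcd≡1⇒coprime gcd≡1 (p∣m , p∣n)) p-prime)

prime∤* : ∀ {p m n} → Prime p → ¬ p ∣ m → ¬ p ∣ n → ¬ p ∣ m * n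
prime∤* p-prime p∤m p∤n p∣mn = [ p∤m , p∤n ]′ (euclidsLemma _ _ p-prime p∣mn)

prime∤^ : ∀ {p m} → Prime p → ¬ p ∣ m → ∀ n → ¬ p ∣ m ^ n
prime∤^ p-prime p∤m zero    p∣1 = ¬prime[1] (subst Prime (∣1⇒≡1 p∣1) p-prime)
prime∤^ p-prime p∤m (suc n) = prime∤* p-prime p∤m (prime∤^ p-prime p∤m n)

exponent-odd : ∀ l {m} → gcd (l * (l ∸ 1)) m ≡ 1 → ¬ 2 ∣ m
exponent-odd l gcd≡1 = coprime⇒∤ gcd≡1 prime[2] (2∣n*[n∸1] l)

prime[3] : Prime 3
prime[3] = from-yes (prime? 3)

2^r*3^s≢0 : ∀ r s → NonZero (2 ^ r * 3 ^ s)
2^r*3^s≢0 r s = m*n≢0 (2 ^ r) (3 ^ s) {{m^n≢0 2 r}} {{m^n≢0 3 s}}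

module _ {U V : FinGroup} (gcd≡1 : gcd (FinGroup.order U) (FinGroup.order V) ≡ 1) where
  private
    u = FinGroup.order U
    prime∤u : ∀ {q} → Prime q → q ∣ FinGroup.order V → ¬ q ∣ u
    prime∤u q-prime = coprime⇒∤ (trans (gcd-comm _ u) gcd≡1) q-prime

  H-obstruction-even : ∀ {M r s l m} → (∀ y → pow M y m ≡ FinGroup.ε M) → ¬ 2 ∣ m → 1 ≤ r →
                       IsoTo (HCarrier M r s) (HMul M r s l) V → DensityObstruction U V
  H-obstruction-even {M} {suc r} {s} {l} {m} exponent m-odd (s≤s z≤n) iso =
    u * m * Nq , ∣-trans (m∣m*n m) (m∣m*n Nq) ,
    inj₁ (semidirect-density {M = M} {l = l} {m = m} {{2^r*3^s≢0 (suc r) s}}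
            iso exponent N≡Nq*2 prime[2] (prime∤* prime[2] 2∤u m-odd) (n∣m*n u))
    where
    Nq = 2 ^ r * 3 ^ s
    N≡Nq*2 : 2 ^ suc r * 3 ^ s ≡ Nq * 2
    N≡Nq*2 = rearrange (2 ^ r) (3 ^ s)
      where
      rearrange : ∀ a b → 2 * a * b ≡ a * b * 2
      rearrange = solve-∀
    2∤u : ¬ 2 ∣ u
    2∤u = prime∤u prime[2] (∣-trans (divides Nq N≡Nq*2) (∣-trans (m∣m*n _)
      (∣-reflexive (×↔⇒≡* (isoTo⇒↔ {μ = HMul M (suc r) s l} {V} iso)))))

  H-obstruction-three : ∀ {M s l m} → (∀ y → pow M y m ≡ FinGroup.ε M) → ¬ 3 ∣ m → 1 ≤ s →
                        IsoTo (HCarrier M 0 s) (HMul M 0 s l) V → DensityObstruction U V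
  H-obstruction-three {M} {suc s} {l} {m} exponent 3∤m (s≤s z≤n) iso =
    K * Nq , ∣-trans (∣-trans (m∣m*n m) (n∣m*n 2)) (m∣m*n Nq) ,
    inj₂ (∣-trans (m∣m*n (u * m)) (m∣m*n Nq) ,
          semidirect-density {M = M} {l = l} {m = m} {{2^r*3^s≢0 0 (suc s)}}
            iso exponent N≡Nq*3 prime[3] 3∤K (∣-trans (n∣m*n u) (n∣m*n 2)))
    where
    K = 2 * (u * m)
    Nq = 3 ^ s
    N≡Nq*3 : 2 ^ 0 * 3 ^ suc s ≡ Nq * 3
    N≡Nq*3 = rearrange (3 ^ s)
      where
      rearrange : ∀ a → 1 * (3 * a) ≡ a * 3
      rearrange = solve-∀
    3∤u : ¬ 3 ∣ u
    3∤u = prime∤u prime[3] (∣-trans (divides Nq N≡Nq*3) (∣-trans (m∣m*n _)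
      (∣-reflexive (×↔⇒≡* (isoTo⇒↔ {μ = HMul M 0 (suc s) l} {V} iso)))))
    3∤K : ¬ 3 ∣ K
    3∤K = prime∤* prime[3] (>⇒∤ ≤-refl) (prime∤* prime[3] 3∤u 3∤m)

  H²-obstruction : ∀ {M M′ r s l l′ m m′} →
    (∀ y → pow M y m ≡ FinGroup.ε M) → (∀ y → pow M′ y m′ ≡ FinGroup.ε M′) → ¬ 2 ∣ m → ¬ 2 ∣ m′ →
    1 ≤ r → IsoTo (HCarrier M r 0 × HCarrier M′ 0 s) (prodMul (HMul M r 0 l) (HMul M′ 0 s l′)) V →
    DensityObstruction U V
  H²-obstruction {M} {M′} {suc r} {s} {l} {l′} {m} {m′}
                 exponent exponent′ m-odd m′-odd (s≤s z≤n) iso =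
    K * Nq , ∣-trans (m∣m*n (m * (m′ * N′))) (m∣m*n Nq) ,
    inj₁ (semidirect²-density {M = M} {M′} {l = l} {l′} {m} {m′}
            {{2^r*3^s≢0 (suc r) 0}} {{2^r*3^s≢0 0 s}} iso exponent exponent′
            N≡Nq*2 prime[2] 2∤K (∣-trans (m∣m*n (m′ * N′)) (n∣m*n u)) m′N′∣K*Nq)
    where
    N′ = 2 ^ 0 * 3 ^ s
    Nq = 2 ^ r * 3 ^ 0
    K = u * (m * (m′ * N′))
    N≡Nq*2 : 2 ^ suc r * 3 ^ 0 ≡ Nq * 2
    N≡Nq*2 = rearrange (2 ^ r)
      where
      rearrange : ∀ a → 2 * a * 1 ≡ a * 1 * 2
      rearrange = solve-∀
    2∤u : ¬ 2 ∣ u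
    2∤u = prime∤u prime[2] (∣-trans (divides Nq N≡Nq*2) (∣-trans (∣-trans (m∣m*n _) (m∣m*n _))
      (∣-reflexive (×↔⇒≡* (isoTo⇒↔ {μ = prodMul (HMul M (suc r) 0 l) (HMul M′ 0 s l′)} {V} iso
                              ↔-∘ (*↔× ×-↔ *↔×))))))
    N′-odd : ¬ 2 ∣ N′
    N′-odd = subst (λ n → ¬ 2 ∣ n) (sym (*-identityˡ (3 ^ s))) (prime∤^ prime[2] (from-no (2 ∣? 3)) s)
    2∤K : ¬ 2 ∣ K
    2∤K = prime∤* prime[2] 2∤u (prime∤* prime[2] m-odd (prime∤* prime[2] m′-odd N′-odd))
    m′N′∣K*Nq : m′ * N′ ∣ K * Nq
    m′N′∣K*Nq = ∣-trans (n∣m*n m) (∣-trans (n∣m*n u) (m∣m*n Nq))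

  vcase1-obstruction : VCase1 V → DensityObstruction U V
  vcase1-obstruction
    (_ , M , r , s , l , _ , (_ , _ , m , (_ , exponent , _) , _ , _ , gcd≡1′ , _ , type) , iso) with type
  ... | inj₁ (_ , 1≤r , _) =
    H-obstruction-even {M} {r} {s} {l} {m} exponent (exponent-odd l gcd≡1′) 1≤r iso
  ... | inj₂ (inj₁ (_ , refl , 1≤s , 3∤m)) = H-obstruction-three {M} {s} {l} {m} exponent 3∤m 1≤s iso
  ... | inj₂ (inj₂ (inj₁ (_ , s≤s _ , _))) =
    H-obstruction-even {M} {r} {s} {l} {m} exponent (exponent-odd l gcd≡1′) (s≤s z≤n) iso
  ... | inj₂ (inj₂ (inj₂ (_ , 1≤r , _))) =
    H-obstruction-even {M} {r} {s} {l} {m} exponent (exponent-odd l gcd≡1′) 1≤r iso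

  vcase2-obstruction : VCase2 V → DensityObstruction U V
  vcase2-obstruction
    (M , M′ , r , s , l , l′ , _ , _ , _ , _ , _ , _ , 1≤r , _ , _ , _ , _ , _ ,
     (_ , _ , m , (_ , exponent , _) , _ , _ , gcd≡1′ , _) ,
     (_ , _ , m′ , (_ , exponent′ , _) , _ , _ , gcd≡1″ , _) , iso) =
    H²-obstruction {M} {M′} {r} {s} {l} {l′} {m} {m′} exponent exponent′
      (exponent-odd l gcd≡1′) (exponent-odd l′ gcd≡1″) 1≤r iso

theorem4p7 : (G U V : FinGroup) → IsCIGroup G → IsDirectProductOf G U V
    → gcd (FinGroup.order U) (FinGroup.order V) ≡ 1 → IsAbelian U
    → (VCase1 V ⊎ VCase2 V)
    → (k : ℕ) → 2 ≤ k → ¬ HasKIfProperty G k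
theorem4p7 G U V ci dp gcd≡1 abelian V-shape (suc (suc k)) (s≤s (s≤s z≤n)) (S , kif) =
  1+n≢0 (kif-obstructed {G} {U} {V} ci dp abelian obstruction kif)
  where
  obstruction : DensityObstruction U V
  obstruction = [ vcase1-obstruction {U} {V} gcd≡1 , vcase2-obstruction {U} {V} gcd≡1 ]′ V-shape
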